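{- Let $G=(\mathcal{V},\mathcal{E})$ be a finite undirected connected simple graph, fix $a\in\mathcal{V}$, and consider the simple random walk on $G$. For any vertex $x\neq a$ and any $v\in\mathcal{V}$, $$\mathbb{S}_x(v)\leqslant\deg(x)\cdot\mathrm{d}(a,x).$$
   Context: The simple random walk moves from a vertex to each neighbor with probability $1/\deg$. $\mathbb{S}_x(v)$ is the expected number of times $t\geqslant 0$ at which the walk started at $v$ is at vertex $x$ before it first reaches $a$ (the starting position counts as a visit). $\mathrm{d}$ is graph distance. -}

module Defs where

open import Data.Nat using (ℕ; zero; suc; _<_; _≤_)
import Data.Nat as ℕ
open import Data.Fin using (Fin; _≟_)
open import Data.Bool using (Bool; true; false; if_then_else_)
open import Data.List using (List; foldr; map; allFin)
open import Data.Integer using (+_)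
open import Data.Rational using (ℚ; 0ℚ; 1ℚ; _+_; _*_; _/_)
open import Data.Product using (_×_)
open import Relation.Nullary using (does; ¬_)
open import Relation.Binary.PropositionalEquality using (_≡_)

record SimpleGraph (n : ℕ) : Set where
  field
    adj      : Fin n → Fin n → Bool
    symmetric   : ∀ u w → adj u w ≡ adj w u
    irreflexive : ∀ u → adj u u ≡ false
open SimpleGraph public

module _ {n : ℕ} (G : SimpleGraph n) where

  data Walk : Fin n → Fin n → ℕ → Set where
    nil  : ∀ {u} → Walk u u zero
    cons : ∀ {u w z k} → adj G u w ≡ true → Walk w z k → Walk u z (suc k)

  Connected : Set
  Connected = ∀ u w → Data.Product.∃ λ k → Walk u w k

  IsDist : Fin n → Fin n → ℕ → Set
  IsDist u w k = Walk u w k × (∀ j → Walk u w j → k ≤ j)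

  deg : Fin n → ℕ
  deg x = foldr (λ w acc → if adj G x w then suc acc else acc) zero (allFin n)

  Σv : (Fin n → ℚ) → ℚ
  Σv f = foldr _+_ 0ℚ (map f (allFin n))

  P : Fin n → Fin n → ℚ
  P w y with adj G w y | deg w
  ... | true  | suc m = + 1 / suc m
  ... | _     | _     = 0ℚ

  ind : Bool → ℚ
  ind b = if b then 1ℚ else 0ℚ

  -- killed[a] v t y = Prob_v( X_t = y  and  t < τ_a ),  τ_a = inf{t ≥ 0 : X_t = a}
  killed : Fin n → Fin n → ℕ → Fin n → ℚ
  killed a v zero    y = ind (does (y ≟ v)) * ind (if does (v ≟ a) then false else true)
  killed a v (suc t) y = ind (if does (y ≟ a) then false else true)
                         * Σv (λ w → killed a v t w * P w y)

  -- partial sum  Σ_{t < T} Prob_v( X_t = x, t < τ_a ).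
  -- S_x(v) = Σ_{t ≥ 0} Prob_v(X_t = x, t < τ_a) (Tonelli), a series of
  -- nonnegative terms, so S_x(v) ≤ c  iff  every partial sum is ≤ c.
  Spartial : Fin n → Fin n → Fin n → ℕ → ℚ
  Spartial a x v zero    = 0ℚ
  Spartial a x v (suc T) = Spartial a x v T + killed a v T x

module Submission where

-- Let U_T(w) = Σ_{t<T} P_w(X_t = x, t < τ_a), so that S_x(v) = sup_T U_T(v). The first-step
-- equation U_{T+1} = 1[w ≠ a]·(δ_x + P U_T) gives U_T(a) = 0, the maximum principle U_T ≤ U_T(x)
-- and, because U_T ≤ U_{T+1}, the bound ΔU_T ≤ deg·δ_x off a for the graph Laplacian Δ.
-- Summation by parts then bounds the Dirichlet energy Σ_{p~q} (U_T(p) − U_T(q))² by U_T(x)·deg x.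
-- A shortest a–x path uses each edge at most once, so Cauchy–Schwarz along its k = d(a,x) edges
-- gives U_T(x)² ≤ k·U_T(x)·deg x, that is U_T(x) ≤ deg x·k.

open import Defs
open import Data.Nat using (ℕ; _*_)
open import Data.Fin using (Fin)
open import Data.Integer using (+_)
open import Data.Rational using (ℚ; _≤_; _/_)
open import Relation.Binary.PropositionalEquality using (_≢_)

import Data.Nat as ℕ
import Data.Nat.Properties as ℕ
import Data.Integer as ℤ
import Data.Integer.Properties as ℤ
open import Data.Bool using (Bool; true; false; if_then_else_)
open import Data.Empty using (⊥-elim)
open import Data.Fin using (zero; suc; _≟_)
open import Data.List using (foldr; tabulate)
open import Data.List.Properties using (map-tabulate)
open import Data.Nat.Coprimality using (1-coprimeTo) renaming (sym to coprime-sym)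
open import Data.Product using (∃; _×_; _,_; proj₁; proj₂)
open import Data.Rational using (mkℚ; 0ℚ; 1ℚ; _+_; _-_; -_; 1/_; Positive; positive; nonNegative; nonPositive)
  renaming (_*_ to _·_)
import Data.Rational.Properties as ℚ
open import Data.Rational.Solver using (module +-*-Solver)
open +-*-Solver using (solve; _:+_; _:*_; _:-_; _:=_; con)
open import Data.Sum using (_⊎_; inj₁; inj₂)
open import Function using (id; _∘_)
open import Relation.Binary.PropositionalEquality
  using (_≡_; refl; sym; trans; cong; cong₂; subst; subst₂; module ≡-Reasoning)
open import Relation.Nullary using (Dec; does; yes; no; ¬_)
open import Relation.Nullary.Decidable using (_⊎-dec_)
open import Data.Unit using (⊤; tt)

open import Algebra.Bundles using (CommutativeRing)
open import Algebra.Properties.Semiring.Sum (CommutativeRing.semiring ℚ.+-*-commutativeRing)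
  using (sum; sum-cong-≗; ∑-distrib-+; ∑-comm; *-distribˡ-sum; *-distribʳ-sum; sum-replicate-zero)

fromℕ : ℕ → ℚ
fromℕ m = + m / 1

fromℕ-mkℚ : ∀ m → fromℕ m ≡ mkℚ (+ m) 0 (coprime-sym (1-coprimeTo m))
fromℕ-mkℚ m = ℚ.↥p/↧p≡p _

fromℕ-suc : ∀ m → fromℕ (ℕ.suc m) ≡ 1ℚ + fromℕ m
fromℕ-suc m rewrite fromℕ-mkℚ m =
  cong (_/ 1) (cong (ℤ._+_ (+ 1)) (sym (ℤ.*-identityʳ (+ m))))

fromℕ-* : ∀ m k → fromℕ (m * k) ≡ fromℕ m · fromℕ k
fromℕ-* m k rewrite fromℕ-mkℚ m | fromℕ-mkℚ k = cong (_/ 1) (ℤ.pos-* m k)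

fromℕ-nonNeg : ∀ m → 0ℚ ≤ fromℕ m
fromℕ-nonNeg ℕ.zero    = ℚ.≤-refl
fromℕ-nonNeg (ℕ.suc m) =
  subst (0ℚ ≤_) (sym (fromℕ-suc m)) (ℚ.+-mono-≤ (ℚ.nonNegative⁻¹ 1ℚ) (fromℕ-nonNeg m))

-- 1/d, with the junk value 1/0 = 0
recip : ℕ → ℚ
recip ℕ.zero    = 0ℚ
recip (ℕ.suc m) = + 1 / ℕ.suc m

recip-nonNeg : ∀ d → 0ℚ ≤ recip d
recip-nonNeg ℕ.zero    = ℚ.≤-refl
recip-nonNeg (ℕ.suc m) = ℚ.nonNegative⁻¹ _ {{ℚ.normalize-nonNeg 1 (ℕ.suc m)}}

fromℕ-suc·recip : ∀ m → fromℕ (ℕ.suc m) · recip (ℕ.suc m) ≡ 1ℚ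
fromℕ-suc·recip m rewrite fromℕ-mkℚ (ℕ.suc m) =
  trans (cong (p ·_) (ℚ.↥p/↧p≡p (1/ p))) (ℚ.*-inverseʳ p)
  where
  p : ℚ
  p = mkℚ (+ ℕ.suc m) 0 (coprime-sym (1-coprimeTo (ℕ.suc m)))

fromℕ·recip≤1 : ∀ d → fromℕ d · recip d ≤ 1ℚ
fromℕ·recip≤1 ℕ.zero    = ℚ.nonNegative⁻¹ 1ℚ
fromℕ·recip≤1 (ℕ.suc m) = ℚ.≤-reflexive (fromℕ-suc·recip m)

nonNeg-· : ∀ {p q} → 0ℚ ≤ p → 0ℚ ≤ q → 0ℚ ≤ p · q
nonNeg-· {p} {q} hp hq = subst (_≤ p · q) (ℚ.*-zeroʳ p) (ℚ.*-monoˡ-≤-nonNeg p {{nonNegative hp}} hq)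

·-monoˡ-≤ : ∀ {r p q} → 0ℚ ≤ r → p ≤ q → r · p ≤ r · q
·-monoˡ-≤ {r} hr = ℚ.*-monoˡ-≤-nonNeg r {{nonNegative hr}}

·-monoʳ-≤ : ∀ {r p q} → 0ℚ ≤ r → p ≤ q → p · r ≤ q · r
·-monoʳ-≤ {r} hr = ℚ.*-monoʳ-≤-nonNeg r {{nonNegative hr}}

square-nonNeg : ∀ d → 0ℚ ≤ d · d
square-nonNeg d with ℚ.≤-total 0ℚ d
... | inj₁ h = nonNeg-· h h
... | inj₂ h = subst (_≤ d · d) (ℚ.*-zeroʳ d) (ℚ.*-monoˡ-≤-nonPos d {{nonPositive h}} h)

0≤q-p⇒p≤q : ∀ {p q} → 0ℚ ≤ q - p → p ≤ q
0≤q-p⇒p≤q {p} {q} h = subst₂ _≤_ (ℚ.+-identityʳ p)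
  (solve 2 (λ p q → p :+ (q :- p) := q) refl p q) (ℚ.+-monoʳ-≤ p h)

p≤q⇒0≤q-p : ∀ {p q} → p ≤ q → 0ℚ ≤ q - p
p≤q⇒0≤q-p {p} {q} h = subst (_≤ q - p) (ℚ.+-inverseʳ p) (ℚ.+-monoˡ-≤ (- p) h)

p+p≤q+q⇒p≤q : ∀ {p q} → p + p ≤ q + q → p ≤ q
p+p≤q+q⇒p≤q {p} {q} h = ℚ.*-cancelˡ-≤-pos (1ℚ + 1ℚ)
  (subst₂ _≤_ (double p) (double q) h)
  where
  double : ∀ r → r + r ≡ (1ℚ + 1ℚ) · r
  double = solve 1 (λ r → r :+ r := (con 1ℚ :+ con 1ℚ) :* r) refl

u≤K·c : ∀ {c u K E} .{{_ : Positive c}} → (c + c) · u - K · (c · c) ≤ E → E ≤ u · c → u ≤ K · c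
u≤K·c {c} {u} {K} lower upper = 0≤q-p⇒p≤q (ℚ.*-cancelˡ-≤-pos c (subst₂ _≤_ (sym (ℚ.*-zeroʳ c))
  (solve 3 (λ c u K → u :* c :- ((c :+ c) :* u :- K :* (c :* c)) := c :* (K :* c :- u)) refl c u K)
  (p≤q⇒0≤q-p (ℚ.≤-trans lower upper))))

𝟙 : Bool → ℚ
𝟙 b = if b then 1ℚ else 0ℚ

𝟙-nonNeg : ∀ b → 0ℚ ≤ 𝟙 b
𝟙-nonNeg true  = ℚ.nonNegative⁻¹ 1ℚ
𝟙-nonNeg false = ℚ.≤-refl

𝟙≤1 : ∀ b → 𝟙 b ≤ 1ℚ
𝟙≤1 true  = ℚ.≤-refl
𝟙≤1 false = ℚ.nonNegative⁻¹ 1ℚ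

sum-tabulate : ∀ {n} (f : Fin n → ℚ) → foldr _+_ 0ℚ (tabulate f) ≡ sum f
sum-tabulate {ℕ.zero}  f = refl
sum-tabulate {ℕ.suc n} f = cong (_+_ (f zero)) (sum-tabulate (f ∘ suc))

Σv≡sum : ∀ {n} (G : SimpleGraph n) f → Σv G f ≡ sum f
Σv≡sum G f = trans (cong (foldr _+_ 0ℚ) (map-tabulate id f)) (sum-tabulate f)

sum-mono-≤ : ∀ {n} {f g : Fin n → ℚ} → (∀ i → f i ≤ g i) → sum f ≤ sum g
sum-mono-≤ {ℕ.zero}  h = ℚ.≤-refl
sum-mono-≤ {ℕ.suc n} h = ℚ.+-mono-≤ (h zero) (sum-mono-≤ (h ∘ suc))

sum-nonNeg : ∀ {n} {f : Fin n → ℚ} → (∀ i → 0ℚ ≤ f i) → 0ℚ ≤ sum f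
sum-nonNeg {n} {f} h = subst (_≤ sum f) (sum-replicate-zero n) (sum-mono-≤ h)

δ : ∀ {n} → Fin n → Fin n → ℚ
δ i j = 𝟙 (does (i ≟ j))

δ-nonNeg : ∀ {n} (i j : Fin n) → 0ℚ ≤ δ i j
δ-nonNeg i j = 𝟙-nonNeg (does (i ≟ j))

δ-refl : ∀ {n} (i : Fin n) → δ i i ≡ 1ℚ
δ-refl i with i ≟ i
... | yes _  = refl
... | no i≢i = ⊥-elim (i≢i refl)

δ-≢ : ∀ {n} {i j : Fin n} → i ≢ j → δ i j ≡ 0ℚ
δ-≢ {i = i} {j} i≢j with i ≟ j
... | yes i≡j = ⊥-elim (i≢j i≡j)
... | no _    = refl

δ-sym : ∀ {n} (i j : Fin n) → δ i j ≡ δ j i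
δ-sym i j with i ≟ j
... | yes refl = sym (δ-refl i)
... | no i≢j   = sym (δ-≢ (i≢j ∘ sym))

δ-suc : ∀ {n} (i j : Fin n) → δ (suc i) (suc j) ≡ δ i j
δ-suc i j with i ≟ j
... | yes _ = refl
... | no _  = refl

sum-δˡ : ∀ {n} (j : Fin n) (g : Fin n → ℚ) → sum (λ i → δ i j · g i) ≡ g j
sum-δˡ {ℕ.suc n} zero g = begin
  1ℚ · g zero + sum (λ i → 0ℚ · g (suc i))
    ≡⟨ cong₂ _+_ (ℚ.*-identityˡ (g zero)) (sum-cong-≗ (ℚ.*-zeroˡ ∘ g ∘ suc)) ⟩
  g zero + sum {n} (λ _ → 0ℚ)
    ≡⟨ trans (cong (_+_ (g zero)) (sum-replicate-zero n)) (ℚ.+-identityʳ (g zero)) ⟩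
  g zero ∎
  where open ≡-Reasoning
sum-δˡ {ℕ.suc n} (suc j) g = begin
  0ℚ · g zero + sum (λ i → δ (suc i) (suc j) · g (suc i))
    ≡⟨ cong₂ _+_ (ℚ.*-zeroˡ (g zero)) (sum-cong-≗ λ i → cong (_· g (suc i)) (δ-suc i j)) ⟩
  0ℚ + sum (λ i → δ i j · g (suc i))
    ≡⟨ trans (ℚ.+-identityˡ _) (sum-δˡ j (g ∘ suc)) ⟩
  g (suc j) ∎
  where open ≡-Reasoning

sum-δʳ : ∀ {n} (i : Fin n) (g : Fin n → ℚ) → sum (λ j → δ i j · g j) ≡ g i
sum-δʳ i g = trans (sum-cong-≗ λ j → cong (_· g j) (δ-sym i j)) (sum-δˡ i g)

term≤sum : ∀ {n} {f : Fin n → ℚ} → (∀ j → 0ℚ ≤ f j) → ∀ i → f i ≤ sum f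
term≤sum {f = f} f≥0 i = subst (_≤ sum f) (sum-δʳ i f) (sum-mono-≤ λ j →
  ℚ.≤-trans (·-monoʳ-≤ (f≥0 j) (𝟙≤1 (does (i ≟ j)))) (ℚ.≤-reflexive (ℚ.*-identityˡ (f j))))

sum² : ∀ {n} → (Fin n → Fin n → ℚ) → ℚ
sum² h = sum λ p → sum λ q → h p q

sum²-distrib-+ : ∀ {n} (g h : Fin n → Fin n → ℚ) → sum² (λ p q → g p q + h p q) ≡ sum² g + sum² h
sum²-distrib-+ g h = trans (sum-cong-≗ λ p → ∑-distrib-+ (g p) (h p)) (∑-distrib-+ (sum ∘ g) (sum ∘ h))

sum²-mono-≤ : ∀ {n} {g h : Fin n → Fin n → ℚ} → (∀ p q → g p q ≤ h p q) → sum² g ≤ sum² h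
sum²-mono-≤ g≤h = sum-mono-≤ λ p → sum-mono-≤ (g≤h p)

sum²-zero : ∀ n → sum² {n} (λ _ _ → 0ℚ) ≡ 0ℚ
sum²-zero n = begin
  sum {n} (λ _ → sum {n} λ _ → 0ℚ) ≡⟨ sum-cong-≗ {n} (λ _ → sum-replicate-zero n) ⟩
  sum {n} (λ _ → 0ℚ)               ≡⟨ sum-replicate-zero n ⟩
  0ℚ                               ∎
  where open ≡-Reasoning

sum²-δδ : ∀ {n} (u w : Fin n) (h : Fin n → Fin n → ℚ) → sum² (λ p q → (δ u p · δ w q) · h p q) ≡ h u w
sum²-δδ u w h = begin
  sum² (λ p q → (δ u p · δ w q) · h p q)
    ≡⟨ sum-cong-≗ (λ p → sum-cong-≗ λ q → ℚ.*-assoc (δ u p) (δ w q) (h p q)) ⟩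
  sum (λ p → sum (λ q → δ u p · (δ w q · h p q)))
    ≡⟨ sum-cong-≗ (λ p → *-distribˡ-sum (δ u p) (λ q → δ w q · h p q)) ⟨
  sum (λ p → δ u p · sum (λ q → δ w q · h p q))
    ≡⟨ sum-cong-≗ (λ p → cong (δ u p ·_) (sum-δʳ w (h p))) ⟩
  sum (λ p → δ u p · h p w)
    ≡⟨ sum-δʳ u (λ p → h p w) ⟩
  h u w ∎
  where open ≡-Reasoning

evolve : ∀ {n} → (Fin n → Fin n → ℚ) → (Fin n → ℚ) → ℕ → Fin n → ℚ
evolve Q μ ℕ.zero    = μ
evolve Q μ (ℕ.suc t) = λ z → sum (λ w → evolve Q μ t w · Q w z)

evolve-cong : ∀ {n} (Q : Fin n → Fin n → ℚ) {μ ν} → (∀ z → μ z ≡ ν z) →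
  ∀ t z → evolve Q μ t z ≡ evolve Q ν t z
evolve-cong Q μ≗ν ℕ.zero    z = μ≗ν z
evolve-cong Q μ≗ν (ℕ.suc t) z = sum-cong-≗ λ w → cong (_· Q w z) (evolve-cong Q μ≗ν t w)

evolve-suc : ∀ {n} (Q : Fin n → Fin n → ℚ) μ t z →
  evolve Q μ (ℕ.suc t) z ≡ evolve Q (evolve Q μ 1) t z
evolve-suc Q μ ℕ.zero    z = refl
evolve-suc Q μ (ℕ.suc t) z = sum-cong-≗ λ w → cong (_· Q w z) (evolve-suc Q μ t w)

evolve-linear : ∀ {n} (Q : Fin n → Fin n → ℚ) (c : Fin n → ℚ) (ν : Fin n → Fin n → ℚ) t z →
  evolve Q (λ z → sum (λ y → c y · ν y z)) t z ≡ sum (λ y → c y · evolve Q (ν y) t z)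
evolve-linear Q c ν ℕ.zero    z = refl
evolve-linear Q c ν (ℕ.suc t) z = begin
  sum (λ w → evolve Q (λ z → sum (λ y → c y · ν y z)) t w · Q w z)
    ≡⟨ sum-cong-≗ (λ w → trans (cong (_· Q w z) (evolve-linear Q c ν t w))
                               (*-distribʳ-sum (Q w z) (λ y → c y · evolve Q (ν y) t w))) ⟩
  sum (λ w → sum (λ y → (c y · evolve Q (ν y) t w) · Q w z))
    ≡⟨ ∑-comm (λ w y → (c y · evolve Q (ν y) t w) · Q w z) ⟩
  sum (λ y → sum (λ w → (c y · evolve Q (ν y) t w) · Q w z))
    ≡⟨ sum-cong-≗ (λ y → trans (sum-cong-≗ λ w → ℚ.*-assoc (c y) _ (Q w z))
                               (sym (*-distribˡ-sum (c y) (λ w → evolve Q (ν y) t w · Q w z)))) ⟩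
  sum (λ y → c y · sum (λ w → evolve Q (ν y) t w · Q w z)) ∎
  where open ≡-Reasoning

-- deg G w is definitionally count (adj G w) id
count : ∀ {m n} → (Fin n → Bool) → (Fin m → Fin n) → ℕ
count b h = foldr (λ w acc → if b w then ℕ.suc acc else acc) ℕ.zero (tabulate h)

fromℕ-count : ∀ {m n} (b : Fin n → Bool) (h : Fin m → Fin n) → fromℕ (count b h) ≡ sum (𝟙 ∘ b ∘ h)
fromℕ-count {ℕ.zero}  b h = refl
fromℕ-count {ℕ.suc m} b h with b (h zero)
... | true  = trans (fromℕ-suc (count b (h ∘ suc))) (cong (_+_ 1ℚ) (fromℕ-count b (h ∘ suc)))
... | false = trans (fromℕ-count b (h ∘ suc)) (sym (ℚ.+-identityˡ (sum (𝟙 ∘ b ∘ h ∘ suc))))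

module _ {n : ℕ} (G : SimpleGraph n) where

  A : Fin n → Fin n → ℚ
  A w y = 𝟙 (adj G w y)

  A-sym : ∀ w y → A w y ≡ A y w
  A-sym w y = cong 𝟙 (symmetric G w y)

  A-nonNeg : ∀ w y → 0ℚ ≤ A w y
  A-nonNeg w y = 𝟙-nonNeg (adj G w y)

  degℚ : Fin n → ℚ
  degℚ w = fromℕ (deg G w)

  degℚ≡sum-A : ∀ w → degℚ w ≡ sum (A w)
  degℚ≡sum-A w = fromℕ-count (adj G w) id

  A≤degℚ : ∀ w y → A w y ≤ degℚ w
  A≤degℚ w y = subst (A w y ≤_) (sym (degℚ≡sum-A w)) (term≤sum (A-nonNeg w) y)

  A-isolated : ∀ {w} → deg G w ≡ 0 → ∀ y → A w y ≡ 0ℚ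
  A-isolated {w} deg≡0 y = ℚ.≤-antisym (subst (A w y ≤_) (cong fromℕ deg≡0) (A≤degℚ w y)) (A-nonNeg w y)

  P≡A·recip : ∀ w y → P G w y ≡ A w y · recip (deg G w)
  P≡A·recip w y with adj G w y | deg G w
  ... | true  | ℕ.suc m = sym (ℚ.*-identityˡ (recip (ℕ.suc m)))
  ... | true  | ℕ.zero  = refl
  ... | false | d       = sym (ℚ.*-zeroˡ (recip d))

  P-nonNeg : ∀ w y → 0ℚ ≤ P G w y
  P-nonNeg w y = subst (0ℚ ≤_) (sym (P≡A·recip w y)) (nonNeg-· (A-nonNeg w y) (recip-nonNeg (deg G w)))

  sum-P≤1 : ∀ w → sum (P G w) ≤ 1ℚ
  sum-P≤1 w = subst (_≤ 1ℚ) sum-P≡ (fromℕ·recip≤1 (deg G w))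
    where
    open ≡-Reasoning
    sum-P≡ : degℚ w · recip (deg G w) ≡ sum (P G w)
    sum-P≡ = begin
      degℚ w · recip (deg G w)               ≡⟨ cong (_· recip (deg G w)) (degℚ≡sum-A w) ⟩
      sum (A w) · recip (deg G w)            ≡⟨ *-distribʳ-sum (recip (deg G w)) (A w) ⟩
      sum (λ y → A w y · recip (deg G w))    ≡⟨ sum-cong-≗ (sym ∘ P≡A·recip w) ⟩
      sum (P G w)                            ∎

  degℚ·P≡A : ∀ w y → degℚ w · P G w y ≡ A w y
  degℚ·P≡A w y rewrite P≡A·recip w y with deg G w in deg≡
  ... | ℕ.zero  = trans (ℚ.*-zeroˡ (A w y · 0ℚ)) (sym (A-isolated deg≡ y))
  ... | ℕ.suc m = begin
    fromℕ (ℕ.suc m) · (A w y · recip (ℕ.suc m))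
      ≡⟨ solve 3 (λ d a r → d :* (a :* r) := a :* (d :* r)) refl (fromℕ (ℕ.suc m)) (A w y) (recip (ℕ.suc m)) ⟩
    A w y · (fromℕ (ℕ.suc m) · recip (ℕ.suc m))
      ≡⟨ cong (A w y ·_) (fromℕ-suc·recip m) ⟩
    A w y · 1ℚ
      ≡⟨ ℚ.*-identityʳ (A w y) ⟩
    A w y ∎
    where open ≡-Reasoning

  Δ : (Fin n → ℚ) → Fin n → ℚ
  Δ f w = sum (λ y → A w y · (f w - f y))

  Δ≡degℚ·f-sum-A·f : ∀ f w → Δ f w ≡ degℚ w · f w - sum (λ y → A w y · f y)
  Δ≡degℚ·f-sum-A·f f w = begin
    Δ f w
      ≡⟨ solve 2 (λ D S → D := (D :+ S) :- S) refl (Δ f w) S ⟩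
    (Δ f w + S) - S
      ≡⟨ cong (_- S) (∑-distrib-+ (λ y → A w y · (f w - f y)) (λ y → A w y · f y)) ⟨
    sum (λ y → A w y · (f w - f y) + A w y · f y) - S
      ≡⟨ cong (_- S) (sum-cong-≗ λ y →
           solve 3 (λ a u v → a :* (u :- v) :+ a :* v := a :* u) refl (A w y) (f w) (f y)) ⟩
    sum (λ y → A w y · f w) - S
      ≡⟨ cong (_- S) (*-distribʳ-sum (f w) (A w)) ⟨
    sum (A w) · f w - S
      ≡⟨ cong (λ d → d · f w - S) (degℚ≡sum-A w) ⟨
    degℚ w · f w - S ∎
    where
    open ≡-Reasoning
    S : ℚ
    S = sum (λ y → A w y · f y)

  sum-A·≡degℚ·sum-P· : ∀ (f : Fin n → ℚ) w →
    sum (λ y → A w y · f y) ≡ degℚ w · sum (λ y → P G w y · f y)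
  sum-A·≡degℚ·sum-P· f w = begin
    sum (λ y → A w y · f y)                 ≡⟨ sum-cong-≗ (λ y → cong (_· f y) (degℚ·P≡A w y)) ⟨
    sum (λ y → (degℚ w · P G w y) · f y)    ≡⟨ sum-cong-≗ (λ y → ℚ.*-assoc (degℚ w) (P G w y) (f y)) ⟩
    sum (λ y → degℚ w · (P G w y · f y))    ≡⟨ *-distribˡ-sum (degℚ w) (λ y → P G w y · f y) ⟨
    degℚ w · sum (λ y → P G w y · f y)      ∎
    where open ≡-Reasoning

  edgeTerm : (Fin n → ℚ) → Fin n → Fin n → ℚ
  edgeTerm f p q = A p q · ((f p - f q) · (f p - f q))

  edgeTerm-nonNeg : ∀ f p q → 0ℚ ≤ edgeTerm f p q
  edgeTerm-nonNeg f p q = nonNeg-· (A-nonNeg p q) (square-nonNeg (f p - f q))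

  energy : (Fin n → ℚ) → ℚ
  energy f = sum² (edgeTerm f)

  energy≡sum-f·Δf : ∀ f → energy f ≡ sum (λ w → f w · Δ f w) + sum (λ w → f w · Δ f w)
  energy≡sum-f·Δf f = begin
    energy f
      ≡⟨ sum-cong-≗ (λ p → sum-cong-≗ (split p)) ⟩
    sum (λ p → sum (λ q → B p q + B q p))
      ≡⟨ sum²-distrib-+ B (λ p q → B q p) ⟩
    sum (sum ∘ B) + sum (λ p → sum (λ q → B q p))
      ≡⟨ cong (_+_ (sum (sum ∘ B))) (∑-comm (λ p q → B q p)) ⟩
    sum (sum ∘ B) + sum (sum ∘ B)
      ≡⟨ cong₂ _+_ sum-B sum-B ⟩
    sum (λ w → f w · Δ f w) + sum (λ w → f w · Δ f w) ∎
    where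
    open ≡-Reasoning
    B : Fin n → Fin n → ℚ
    B p q = A p q · (f p · (f p - f q))
    split : ∀ p q → A p q · ((f p - f q) · (f p - f q)) ≡ B p q + B q p
    split p q rewrite A-sym q p =
      solve 3 (λ a u v → a :* ((u :- v) :* (u :- v)) := a :* (u :* (u :- v)) :+ a :* (v :* (v :- u))) refl (A p q) (f p) (f q)
    sum-B : sum (sum ∘ B) ≡ sum (λ w → f w · Δ f w)
    sum-B = sum-cong-≗ λ p → trans
      (sum-cong-≗ λ q → solve 3 (λ a u d → a :* (u :* d) := u :* (a :* d)) refl (A p q) (f p) (f p - f q))
      (sym (*-distribˡ-sum (f p) (λ q → A p q · (f p - f q))))

  energy-bound : ∀ {a x} (f : Fin n → ℚ) → (∀ w → 0ℚ ≤ f w) → f a ≡ 0ℚ →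
    (∀ w → w ≢ a → Δ f w ≤ degℚ w · δ x w) → energy f ≤ f x · degℚ x + f x · degℚ x
  energy-bound {a} {x} f f≥0 fa≡0 Δf≤ =
    subst (_≤ f x · degℚ x + f x · degℚ x) (sym (energy≡sum-f·Δf f)) (ℚ.+-mono-≤ sum≤ sum≤)
    where
    term≤ : ∀ w → f w · Δ f w ≤ δ x w · (f w · degℚ w)
    term≤ w with w ≟ a
    ... | yes refl = subst (_≤ δ x w · (f w · degℚ w)) (sym (trans (cong (_· Δ f w) fa≡0) (ℚ.*-zeroˡ (Δ f w))))
                       (nonNeg-· (𝟙-nonNeg (does (x ≟ w))) (nonNeg-· (f≥0 w) (fromℕ-nonNeg (deg G w))))
    ... | no w≢a   = ℚ.≤-trans (·-monoˡ-≤ (f≥0 w) (Δf≤ w w≢a)) (ℚ.≤-reflexive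
      (solve 3 (λ u d e → u :* (d :* e) := e :* (u :* d)) refl (f w) (degℚ w) (δ x w)))
    sum≤ : sum (λ w → f w · Δ f w) ≤ f x · degℚ x
    sum≤ = subst (_ ≤_) (sum-δʳ x (λ w → f w · degℚ w)) (sum-mono-≤ term≤)

  walkEnergy : (Fin n → ℚ) → ∀ {u z k} → Walk G u z k → ℚ
  walkEnergy f nil                  = 0ℚ
  walkEnergy f (cons {u} {w} _ W) = (f w - f u) · (f w - f u) + walkEnergy f W

  -- Summing  2ld − l² ≤ d²  over the steps: Cauchy–Schwarz without square roots.
  walkEnergy-lower : ∀ f l {u z k} (W : Walk G u z k) →
    (l + l) · (f z - f u) - fromℕ k · (l · l) ≤ walkEnergy f W
  walkEnergy-lower f l (nil {u}) = ℚ.≤-reflexive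
    (solve 2 (λ l v → (l :+ l) :* (v :- v) :- con 0ℚ :* (l :* l) := con 0ℚ) refl l (f u))
  walkEnergy-lower f l (cons {u} {w} {z} {k} e W) = begin
    (l + l) · (f z - f u) - fromℕ (ℕ.suc k) · (l · l)
      ≡⟨ cong (λ s → (l + l) · (f z - f u) - s · (l · l)) (fromℕ-suc k) ⟩
    (l + l) · (f z - f u) - (1ℚ + fromℕ k) · (l · l)
      ≡⟨ solve 5 (λ l z u w K → (l :+ l) :* (z :- u) :- (con 1ℚ :+ K) :* (l :* l)
                     := (l :+ l) :* (w :- u) :- l :* l :+ ((l :+ l) :* (z :- w) :- K :* (l :* l)))
                 refl l (f z) (f u) (f w) (fromℕ k) ⟩
    (l + l) · (f w - f u) - l · l + ((l + l) · (f z - f w) - fromℕ k · (l · l))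
      ≤⟨ ℚ.+-mono-≤ (2ld-l²≤d² l (f w - f u)) (walkEnergy-lower f l W) ⟩
    walkEnergy f (cons e W) ∎
    where
    open ℚ.≤-Reasoning
    2ld-l²≤d² : ∀ l d → (l + l) · d - l · l ≤ d · d
    2ld-l²≤d² l d = 0≤q-p⇒p≤q (subst (0ℚ ≤_)
      (solve 2 (λ l d → (d :- l) :* (d :- l) := d :* d :- ((l :+ l) :* d :- l :* l)) refl l d) (square-nonNeg (d - l)))

  _∈ʷ_ : ∀ {u z k} → Fin n → Walk G u z k → Set
  p ∈ʷ nil {u}        = p ≡ u
  p ∈ʷ cons {u} _ W = p ≡ u ⊎ p ∈ʷ W

  _∈ʷ?_ : ∀ {u z k} p (W : Walk G u z k) → Dec (p ∈ʷ W)
  p ∈ʷ? nil {u}        = p ≟ u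
  p ∈ʷ? cons {u} _ W = (p ≟ u) ⊎-dec (p ∈ʷ? W)

  start∈ʷ : ∀ {u z k} (W : Walk G u z k) → u ∈ʷ W
  start∈ʷ nil        = refl
  start∈ʷ (cons _ W) = inj₁ refl

  ∉ʷ⇒≢start : ∀ {w z k p} (W : Walk G w z k) → ¬ (p ∈ʷ W) → w ≢ p
  ∉ʷ⇒≢start W p∉W w≡p = p∉W (subst (_∈ʷ W) w≡p (start∈ʷ W))

  IsPath : ∀ {u z k} → Walk G u z k → Set
  IsPath nil            = ⊤
  IsPath (cons {u} _ W) = ¬ (u ∈ʷ W) × IsPath W

  walk-from-∈ʷ : ∀ {u z k p} (W : Walk G u z k) → p ∈ʷ W → ∃ λ j → j ℕ.≤ k × Walk G p z j
  walk-from-∈ʷ nil refl                     = 0 , ℕ.z≤n , nil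
  walk-from-∈ʷ {k = k} (cons e W) (inj₁ refl) = k , ℕ.≤-refl , cons e W
  walk-from-∈ʷ (cons e W) (inj₂ p∈W) with walk-from-∈ʷ W p∈W
  ... | j , j≤k , W′ = j , ℕ.m≤n⇒m≤1+n j≤k , W′

  shortcut-or-path : ∀ {u z k} (W : Walk G u z k) → (∃ λ j → j ℕ.< k × Walk G u z j) ⊎ IsPath W
  shortcut-or-path nil = inj₂ tt
  shortcut-or-path (cons {u} e W) with shortcut-or-path W
  ... | inj₁ (j , j<k , W′) = inj₁ (ℕ.suc j , ℕ.s≤s j<k , cons e W′)
  ... | inj₂ W-path with u ∈ʷ? W
  ...   | no u∉W    = inj₂ (u∉W , W-path)
  ...   | yes u∈W with walk-from-∈ʷ W u∈W
  ...     | j , j≤k , W′ = inj₁ (j , ℕ.s≤s j≤k , W′)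

  shortest⇒path : ∀ {u z k} (W : Walk G u z k) → (∀ j → Walk G u z j → k ℕ.≤ j) → IsPath W
  shortest⇒path W shortest with shortcut-or-path W
  ... | inj₁ (j , j<k , W′) = ⊥-elim (ℕ.<⇒≱ j<k (shortest j W′))
  ... | inj₂ W-path         = W-path

  crossings : ∀ {u z k} → Walk G u z k → Fin n → Fin n → ℚ
  crossings nil                p q = 0ℚ
  crossings (cons {u} {w} _ W) p q = δ u p · δ w q + δ w p · δ u q + crossings W p q

  crossings-∉ : ∀ {u z k} (W : Walk G u z k) {p} → ¬ (p ∈ʷ W) →
    ∀ q → crossings W p q ≡ 0ℚ × crossings W q p ≡ 0ℚ
  crossings-∉ nil p∉W q = refl , refl
  crossings-∉ (cons {u} {w} _ W) {p} p∉W q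
    rewrite δ-≢ {i = u} {p} (λ u≡p → p∉W (inj₁ (sym u≡p)))
          | δ-≢ (∉ʷ⇒≢start W (p∉W ∘ inj₂))
          | proj₁ (crossings-∉ W (p∉W ∘ inj₂) q)
          | proj₂ (crossings-∉ W (p∉W ∘ inj₂) q)
    = solve 2 (λ a b → con 0ℚ :* a :+ con 0ℚ :* b :+ con 0ℚ := con 0ℚ) refl (δ w q) (δ u q)
    , solve 2 (λ a b → a :* con 0ℚ :+ b :* con 0ℚ :+ con 0ℚ := con 0ℚ) refl (δ u q) (δ w q)

  crossings≤1 : ∀ {u z k} (W : Walk G u z k) → IsPath W → ∀ p q → crossings W p q ≤ 1ℚ
  crossings≤1 nil _ p q = ℚ.nonNegative⁻¹ 1ℚ
  crossings≤1 (cons {u} {w} _ W) (u∉W , W-path) p q with p ≟ u | q ≟ u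
  ... | yes refl | _
    rewrite δ-refl u | δ-≢ (∉ʷ⇒≢start W u∉W) | proj₁ (crossings-∉ W u∉W q)
    = subst (_≤ 1ℚ) (solve 2 (λ a b → a := con 1ℚ :* a :+ con 0ℚ :* b :+ con 0ℚ) refl (δ w q) (δ u q)) (𝟙≤1 _)
  ... | no p≢u | yes refl
    rewrite δ-refl u | δ-≢ (p≢u ∘ sym) | proj₂ (crossings-∉ W u∉W p)
    = subst (_≤ 1ℚ) (solve 2 (λ a b → b := con 0ℚ :* a :+ b :* con 1ℚ :+ con 0ℚ) refl (δ w u) (δ w p)) (𝟙≤1 _)
  ... | no p≢u | no q≢u
    rewrite δ-≢ (p≢u ∘ sym) | δ-≢ (q≢u ∘ sym)
    = subst (_≤ 1ℚ) (solve 3 (λ a b c → c := con 0ℚ :* a :+ b :* con 0ℚ :+ c) refl (δ w q) (δ w p) (crossings W p q))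
        (crossings≤1 W W-path p q)

  stepSum : ∀ {u z k} → Walk G u z k → (Fin n → Fin n → ℚ) → ℚ
  stepSum nil                h = 0ℚ
  stepSum (cons {u} {w} _ W) h = h u w + h w u + stepSum W h

  stepSum≡sum²-crossings : ∀ {u z k} (W : Walk G u z k) h →
    stepSum W h ≡ sum² (λ p q → crossings W p q · h p q)
  stepSum≡sum²-crossings nil h = sym (trans (sum-cong-≗ λ p → sum-cong-≗ λ q → ℚ.*-zeroˡ (h p q)) (sum²-zero n))
  stepSum≡sum²-crossings (cons {u} {w} _ W) h = sym (begin
    sum² (λ p q → (uw p q + wu p q + crossings W p q) · h p q)
      ≡⟨ sum-cong-≗ (λ p → sum-cong-≗ λ q →
           ℚ.*-distribʳ-+ (h p q) (uw p q + wu p q) (crossings W p q)) ⟩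
    sum² (λ p q → (uw p q + wu p q) · h p q + crossings W p q · h p q)
      ≡⟨ sum²-distrib-+ (λ p q → (uw p q + wu p q) · h p q) (λ p q → crossings W p q · h p q) ⟩
    sum² (λ p q → (uw p q + wu p q) · h p q) + sum² (λ p q → crossings W p q · h p q)
      ≡⟨ cong (_+ sum² (λ p q → crossings W p q · h p q)) (begin
           sum² (λ p q → (uw p q + wu p q) · h p q)
             ≡⟨ sum-cong-≗ (λ p → sum-cong-≗ λ q → ℚ.*-distribʳ-+ (h p q) (uw p q) (wu p q)) ⟩
           sum² (λ p q → uw p q · h p q + wu p q · h p q)
             ≡⟨ sum²-distrib-+ (λ p q → uw p q · h p q) (λ p q → wu p q · h p q) ⟩
           sum² (λ p q → uw p q · h p q) + sum² (λ p q → wu p q · h p q)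
             ≡⟨ cong₂ _+_ (sum²-δδ u w h) (sum²-δδ w u h) ⟩
           h u w + h w u ∎) ⟩
    h u w + h w u + sum² (λ p q → crossings W p q · h p q)
      ≡⟨ cong (_+_ (h u w + h w u)) (stepSum≡sum²-crossings W h) ⟨
    h u w + h w u + stepSum W h ∎)
    where
    open ≡-Reasoning
    uw wu : Fin n → Fin n → ℚ
    uw p q = δ u p · δ w q
    wu p q = δ w p · δ u q

  path-stepSum≤sum² : ∀ {u z k} (W : Walk G u z k) → IsPath W →
    ∀ h → (∀ p q → 0ℚ ≤ h p q) → stepSum W h ≤ sum² h
  path-stepSum≤sum² W W-path h h≥0 = subst (_≤ sum² h) (sym (stepSum≡sum²-crossings W h)) (sum²-mono-≤ λ p q →
    ℚ.≤-trans (·-monoʳ-≤ (h≥0 p q) (crossings≤1 W W-path p q)) (ℚ.≤-reflexive (ℚ.*-identityˡ (h p q))))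

  stepSum-edgeTerm : ∀ f {u z k} (W : Walk G u z k) → stepSum W (edgeTerm f) ≡ walkEnergy f W + walkEnergy f W
  stepSum-edgeTerm f nil = sym (ℚ.+-identityˡ 0ℚ)
  stepSum-edgeTerm f (cons {u} {w} e W) rewrite e | trans (symmetric G w u) e | stepSum-edgeTerm f W =
    solve 3 (λ a b E → con 1ℚ :* ((a :- b) :* (a :- b)) :+ con 1ℚ :* ((b :- a) :* (b :- a)) :+ (E :+ E)
                       := (b :- a) :* (b :- a) :+ E :+ ((b :- a) :* (b :- a) :+ E))
          refl (f u) (f w) (walkEnergy f W)

  path-walkEnergy≤energy : ∀ f {u z k} (W : Walk G u z k) → IsPath W → walkEnergy f W + walkEnergy f W ≤ energy f
  path-walkEnergy≤energy f W W-path =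
    subst (_≤ energy f) (stepSum-edgeTerm f W) (path-stepSum≤sum² W W-path (edgeTerm f) (edgeTerm-nonNeg f))

  last-neighbour : ∀ {u z j} → Walk G u z (ℕ.suc j) → ∃ λ y → adj G z y ≡ true
  last-neighbour (cons {u} {z} e nil)  = u , trans (symmetric G z u) e
  last-neighbour (cons _ (cons e W)) = last-neighbour (cons e W)

  walk-end-degℚ-pos : ∀ {u z k} → Walk G u z k → z ≢ u → Positive (degℚ z)
  walk-end-degℚ-pos nil z≢u = ⊥-elim (z≢u refl)
  walk-end-degℚ-pos {z = z} W@(cons _ _) _ with last-neighbour W
  ... | y , z~y = positive (ℚ.<-≤-trans (ℚ.positive⁻¹ 1ℚ) (subst (_≤ degℚ z) (cong 𝟙 z~y) (A≤degℚ z y)))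

module _ {n : ℕ} (G : SimpleGraph n) (a : Fin n) where

  alive : Fin n → ℚ
  alive w = 𝟙 (if does (w ≟ a) then false else true)

  alive-a : alive a ≡ 0ℚ
  alive-a with a ≟ a
  ... | yes _  = refl
  ... | no a≢a = ⊥-elim (a≢a refl)

  alive-≢ : ∀ {w} → w ≢ a → alive w ≡ 1ℚ
  alive-≢ {w} w≢a with w ≟ a
  ... | yes w≡a = ⊥-elim (w≢a w≡a)
  ... | no _    = refl

  alive-nonNeg : ∀ w → 0ℚ ≤ alive w
  alive-nonNeg w = 𝟙-nonNeg _

  Pᵃ : Fin n → Fin n → ℚ
  Pᵃ w z = P G w z · alive z

  start : Fin n → Fin n → ℚ
  start v z = δ z v · alive v

  killed≡evolve : ∀ v t z → killed G a v t z ≡ evolve Pᵃ (start v) t z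
  killed≡evolve v ℕ.zero    z = refl
  killed≡evolve v (ℕ.suc t) z = begin
    alive z · Σv G (λ w → killed G a v t w · P G w z)
      ≡⟨ cong (alive z ·_) (Σv≡sum G _) ⟩
    alive z · sum (λ w → killed G a v t w · P G w z)
      ≡⟨ *-distribˡ-sum (alive z) (λ w → killed G a v t w · P G w z) ⟩
    sum (λ w → alive z · (killed G a v t w · P G w z))
      ≡⟨ sum-cong-≗ (λ w → trans
           (solve 3 (λ c k p → c :* (k :* p) := k :* (p :* c)) refl (alive z) (killed G a v t w) (P G w z))
           (cong (_· Pᵃ w z) (killed≡evolve v t w))) ⟩
    sum (λ w → evolve Pᵃ (start v) t w · Pᵃ w z) ∎
    where open ≡-Reasoning

  killed-first-step : ∀ v t z → killed G a v (ℕ.suc t) z ≡ alive v · sum (λ y → P G v y · killed G a y t z)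
  killed-first-step v t z = begin
    killed G a v (ℕ.suc t) z                           ≡⟨ killed≡evolve v (ℕ.suc t) z ⟩
    evolve Pᵃ (start v) (ℕ.suc t) z                    ≡⟨ evolve-suc Pᵃ (start v) t z ⟩
    evolve Pᵃ (evolve Pᵃ (start v) 1) t z              ≡⟨ evolve-cong Pᵃ one-step t z ⟩
    evolve Pᵃ (λ z → sum (λ y → c y · start y z)) t z  ≡⟨ evolve-linear Pᵃ c start t z ⟩
    sum (λ y → c y · evolve Pᵃ (start y) t z)          ≡⟨ sum-cong-≗ (λ y → cong (c y ·_) (killed≡evolve y t z)) ⟨
    sum (λ y → c y · killed G a y t z)                 ≡⟨ sum-cong-≗ (λ y → ℚ.*-assoc (alive v) (P G v y) _) ⟩
    sum (λ y → alive v · (P G v y · killed G a y t z)) ≡⟨ *-distribˡ-sum (alive v) (λ y → P G v y · killed G a y t z) ⟨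
    alive v · sum (λ y → P G v y · killed G a y t z)   ∎
    where
    open ≡-Reasoning
    c : Fin n → ℚ
    c y = alive v · P G v y
    one-step : ∀ z → evolve Pᵃ (start v) 1 z ≡ sum (λ y → c y · start y z)
    one-step z = begin
      sum (λ w → (δ w v · alive v) · Pᵃ w z) ≡⟨ sum-cong-≗ (λ w → ℚ.*-assoc (δ w v) (alive v) (Pᵃ w z)) ⟩
      sum (λ w → δ w v · (alive v · Pᵃ w z)) ≡⟨ sum-δˡ v (λ w → alive v · Pᵃ w z) ⟩
      alive v · (P G v z · alive z)          ≡⟨ ℚ.*-assoc (alive v) (P G v z) (alive z) ⟨
      c z · alive z                          ≡⟨ sum-δʳ z (λ y → c y · alive y) ⟨
      sum (λ y → δ z y · (c y · alive y))    ≡⟨ sum-cong-≗ (λ y →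
        solve 3 (λ d c e → d :* (c :* e) := c :* (d :* e)) refl (δ z y) (c y) (alive y)) ⟩
      sum (λ y → c y · (δ z y · alive y))    ∎

  killed-nonNeg : ∀ v t z → 0ℚ ≤ killed G a v t z
  killed-nonNeg v ℕ.zero    z = nonNeg-· (δ-nonNeg z v) (alive-nonNeg v)
  killed-nonNeg v (ℕ.suc t) z = nonNeg-· (alive-nonNeg z) (subst (0ℚ ≤_) (sym (Σv≡sum G _))
    (sum-nonNeg λ w → nonNeg-· (killed-nonNeg v t w) (P-nonNeg G w z)))

module _ {n : ℕ} (G : SimpleGraph n) (a x : Fin n) where

  U : ℕ → Fin n → ℚ
  U T w = Spartial G a x w T

  U-nonNeg : ∀ T w → 0ℚ ≤ U T w
  U-nonNeg ℕ.zero    w = ℚ.≤-refl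
  U-nonNeg (ℕ.suc T) w = ℚ.+-mono-≤ (U-nonNeg T w) (killed-nonNeg G a w T x)

  U-mono : ∀ T w → U T w ≤ U (ℕ.suc T) w
  U-mono T w = subst (_≤ U (ℕ.suc T) w) (ℚ.+-identityʳ (U T w)) (ℚ.+-monoʳ-≤ (U T w) (killed-nonNeg G a w T x))

  U-first-step : ∀ T w → U (ℕ.suc T) w ≡ alive G a w · (δ x w + sum (λ y → P G w y · U T y))
  U-first-step ℕ.zero w = begin
    0ℚ + δ x w · c
      ≡⟨ solve 2 (λ d c → con 0ℚ :+ d :* c := c :* (d :+ con 0ℚ)) refl (δ x w) c ⟩
    c · (δ x w + 0ℚ)
      ≡⟨ cong (λ s → c · (δ x w + s)) (sum-replicate-zero n) ⟨
    c · (δ x w + sum {n} (λ _ → 0ℚ))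
      ≡⟨ cong (λ s → c · (δ x w + s)) (sum-cong-≗ λ y → ℚ.*-zeroʳ (P G w y)) ⟨
    c · (δ x w + sum (λ y → P G w y · 0ℚ)) ∎
    where
    open ≡-Reasoning
    c : ℚ
    c = alive G a w
  U-first-step (ℕ.suc T) w = begin
    U (ℕ.suc T) w + killed G a w (ℕ.suc T) x
      ≡⟨ cong₂ _+_ (U-first-step T w) (killed-first-step G a w T x) ⟩
    c · (δ x w + sum (λ y → P G w y · U T y)) + c · sum (λ y → P G w y · killed G a y T x)
      ≡⟨ solve 4 (λ c d s k → c :* (d :+ s) :+ c :* k := c :* (d :+ (s :+ k))) refl c (δ x w) _ _ ⟩
    c · (δ x w + (sum (λ y → P G w y · U T y) + sum (λ y → P G w y · killed G a y T x)))
      ≡⟨ cong (λ s → c · (δ x w + s))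
              (∑-distrib-+ (λ y → P G w y · U T y) (λ y → P G w y · killed G a y T x)) ⟨
    c · (δ x w + sum (λ y → P G w y · U T y + P G w y · killed G a y T x))
      ≡⟨ cong (λ s → c · (δ x w + s)) (sum-cong-≗ λ y → ℚ.*-distribˡ-+ (P G w y) (U T y) (killed G a y T x)) ⟨
    c · (δ x w + sum (λ y → P G w y · U (ℕ.suc T) y)) ∎
    where
    open ≡-Reasoning
    c : ℚ
    c = alive G a w

  U-a : ∀ T → U T a ≡ 0ℚ
  U-a ℕ.zero    = refl
  U-a (ℕ.suc T) = trans (U-first-step T a) (trans (cong (_· r) (alive-a G a)) (ℚ.*-zeroˡ r))
    where
    r : ℚ
    r = δ x a + sum (λ y → P G a y · U T y)

  U-first-step-≢ : ∀ T {w} → w ≢ a → U (ℕ.suc T) w ≡ δ x w + sum (λ y → P G w y · U T y)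
  U-first-step-≢ T {w} w≢a = trans (U-first-step T w) (trans (cong (_· r) (alive-≢ G a w≢a)) (ℚ.*-identityˡ r))
    where
    r : ℚ
    r = δ x w + sum (λ y → P G w y · U T y)

  U≤U-x : ∀ T w → U T w ≤ U T x
  U≤U-x ℕ.zero    w = ℚ.≤-refl
  U≤U-x (ℕ.suc T) w with w ≟ a | w ≟ x
  ... | yes refl | _        = subst (_≤ U (ℕ.suc T) x) (sym (U-a (ℕ.suc T))) (U-nonNeg (ℕ.suc T) x)
  ... | no _     | yes refl = ℚ.≤-refl
  ... | no w≢a   | no w≢x   = begin
    U (ℕ.suc T) w                          ≡⟨ U-first-step-≢ T w≢a ⟩
    δ x w + sum (λ y → P G w y · U T y)    ≡⟨ cong (_+ sum (λ y → P G w y · U T y)) (δ-≢ (w≢x ∘ sym)) ⟩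
    0ℚ + sum (λ y → P G w y · U T y)       ≡⟨ ℚ.+-identityˡ _ ⟩
    sum (λ y → P G w y · U T y)            ≤⟨ sum-mono-≤ (λ y → ·-monoˡ-≤ (P-nonNeg G w y) (U≤U-x T y)) ⟩
    sum (λ y → P G w y · U T x)            ≡⟨ *-distribʳ-sum (U T x) (P G w) ⟨
    sum (P G w) · U T x                    ≤⟨ ·-monoʳ-≤ (U-nonNeg T x) (sum-P≤1 G w) ⟩
    1ℚ · U T x                             ≡⟨ ℚ.*-identityˡ _ ⟩
    U T x                                  ≤⟨ U-mono T x ⟩
    U (ℕ.suc T) x                          ∎
    where open ℚ.≤-Reasoning

  Δ-U≤degℚ·δ : ∀ T w → w ≢ a → Δ G (U T) w ≤ degℚ G w · δ x w
  Δ-U≤degℚ·δ T w w≢a =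
    0≤q-p⇒p≤q (subst (0ℚ ≤_) d·growth≡ (nonNeg-· (fromℕ-nonNeg (deg G w)) (p≤q⇒0≤q-p (U-mono T w))))
    where
    open ≡-Reasoning
    d S : ℚ
    d = degℚ G w
    S = sum (λ y → P G w y · U T y)
    d·growth≡ : d · (U (ℕ.suc T) w - U T w) ≡ d · δ x w - Δ G (U T) w
    d·growth≡ = begin
      d · (U (ℕ.suc T) w - U T w)
        ≡⟨ cong (λ u → d · (u - U T w)) (U-first-step-≢ T w≢a) ⟩
      d · ((δ x w + S) - U T w)
        ≡⟨ solve 4 (λ d e s u → d :* ((e :+ s) :- u) := d :* e :- (d :* u :- d :* s)) refl d (δ x w) S (U T w) ⟩
      d · δ x w - (d · U T w - d · S)
        ≡⟨ cong (λ s → d · δ x w - (d · U T w - s)) (sum-A·≡degℚ·sum-P· G (U T) w) ⟨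
      d · δ x w - (d · U T w - sum (λ y → A G w y · U T y))
        ≡⟨ cong (_-_ (d · δ x w)) (Δ≡degℚ·f-sum-A·f G (U T) w) ⟨
      d · δ x w - Δ G (U T) w ∎

lemma4 : (n : ℕ) (G : SimpleGraph n) → Connected G →
    (a x v : Fin n) → x ≢ a → (k : ℕ) → IsDist G a x k →
    (T : ℕ) → Spartial G a x v T ≤ (+ (deg G x * k)) / 1
lemma4 n G _ a x v x≢a k (W , shortest) T = begin
  Spartial G a x v T   ≤⟨ U≤U-x G a x T v ⟩
  f x                  ≤⟨ u≤K·c {K = fromℕ k} lower upper ⟩
  fromℕ k · degℚ G x   ≡⟨ trans (ℚ.*-comm (fromℕ k) c) (sym (fromℕ-* (deg G x) k)) ⟩
  fromℕ (deg G x * k)  ∎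
  where
  open ℚ.≤-Reasoning
  f : Fin n → ℚ
  f = U G a x T
  c : ℚ
  c = degℚ G x
  instance
    c-pos : Positive c
    c-pos = walk-end-degℚ-pos G W x≢a
  lower : (c + c) · f x - fromℕ k · (c · c) ≤ walkEnergy G f W
  lower = subst (λ s → (c + c) · s - fromℕ k · (c · c) ≤ walkEnergy G f W)
    (trans (cong (_-_ (f x)) (U-a G a x T)) (ℚ.+-identityʳ (f x))) (walkEnergy-lower G f c W)
  upper : walkEnergy G f W ≤ f x · c
  upper = p+p≤q+q⇒p≤q (ℚ.≤-trans (path-walkEnergy≤energy G f W (shortest⇒path G W shortest))
                                 (energy-bound G f (U-nonNeg G a x T) (U-a G a x T) (Δ-U≤degℚ·δ G a x T)))
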